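{- Let $G$ be a connected graph of order $n\ge 2$ and let $\mathcal{H}=\{H_1,\ldots,H_n\}$ be a family of non-trivial graphs. For any $k\in\{1,\ldots,\min\{\mathcal{T}(G\circ\mathcal{H}),\mathcal{C}(\mathcal{H})\}\}$, $$\dim_k(G\circ\mathcal{H})\ge\sum_{i=1}^n\operatorname{adim}_k(H_i).$$
   Context: All graphs are finite and simple; non-trivial means at least two vertices; $V(G)=\{u_1,\ldots,u_n\}$. The lexicographic product $G\circ\mathcal{H}$ has vertex set $\bigcup_i\{u_i\}\times V(H_i)$, with $(u_i,v)\sim(u_j,w)$ iff $u_iu_j\in E(G)$, or $i=j$ and $vw\in E(H_i)$. For a connected graph $X$, $S\subseteq V(X)$ is a $k$-metric generator if every two distinct vertices $x,y$ admit at least $k$ vertices $w\in S$ with $d_X(x,w)\neq d_X(y,w)$; $\dim_k(X)$ is the minimum cardinality of a $k$-metric generator. For a graph $H$, $S\subseteq V(H)$ is a $k$-adjacency generator if every two distinct $x,y$ satisfy $|((N_H(x)\triangledown N_H(y))\cup\{x,y\})\cap S|\ge k$ ($\triangledown$ = symmetric difference); $\operatorname{adim}_k(H)$ is its minimum cardinality. $\mathcal{C}(H)=\min_{x\neq y}|(N_H(x)\triangledown N_H(y))\cup\{x,y\}|$, $\mathcal{C}(\mathcal{H})=\min_i\mathcal{C}(H_i)$. Twins in $G$: distinct $x,y$ are true twins if $N[x]=N[y]$, false twins if $N(x)=N(y)$; the relation $N(x)-\{y\}=N(y)-\{x\}$ partitions $V(G)$ into singleton classes, false twin classes and true twin classes,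 with unions $S(G)$, $FT(G)$, $TT(G)$ and class of $u_i$ denoted $FT(u_i)$ or $TT(u_i)$. $\mathcal{T}(u_i,\mathcal{H})=|V(H_i)|$ if $u_i\in S(G)$; $=\min\{\delta(H_j)+\delta(H_l)+2: u_j,u_l\in FT(u_i), j\neq l\}$ if $u_i\in FT(G)$; $=\min\{|V(H_j)|-\Delta(H_j)+|V(H_l)|-\Delta(H_l): u_j,u_l\in TT(u_i), j\neq l\}$ if $u_i\in TT(G)$; $\mathcal{T}(G\circ\mathcal{H})=\min_{u_i}\mathcal{T}(u_i,\mathcal{H})$. -}

module Defs where

open import Data.Nat using (ℕ; zero; suc; _+_; _∸_; _≤_; _⊓_; _⊔_)
open import Data.Bool using (Bool; true; false; _∨_; _xor_; if_then_else_)
open import Data.Fin using (Fin; _≟_)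
open import Data.List using (List; []; _∷_; length; allFin; map; foldr; tabulate)
open import Data.Nat.ListAction using (sum)
open import Data.List.Relation.Unary.All using (All)
open import Data.List.Relation.Unary.Unique.Propositional using (Unique)
open import Data.List.Membership.Propositional using (_∈_)
open import Data.Product using (Σ; Σ-syntax; _×_; _,_)
open import Data.Sum using (_⊎_)
open import Relation.Binary.PropositionalEquality using (_≡_; _≢_; refl)
open import Relation.Nullary using (¬_; yes; no)
open import Relation.Nullary.Decidable using (⌊_⌋)

Adj : Set → Set
Adj V = V → V → Bool

record Graph (n : ℕ) : Set where
  field
    adj    : Adj (Fin n)
    sym    : ∀ x y → adj x y ≡ adj y x
    irrefl : ∀ x → adj x x ≡ false
open Graph public

data Walk {V : Set} (A : Adj V) : V → V → ℕ → Set where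
  here : ∀ {x} → Walk A x x 0
  step : ∀ {x y z ℓ} → A x y ≡ true → Walk A y z ℓ → Walk A x z (suc ℓ)

Connected : {V : Set} → Adj V → Set
Connected {V} A = ∀ (x y : V) → Σ ℕ (λ ℓ → Walk A x y ℓ)

IsDist : {V : Set} → Adj V → V → V → ℕ → Set
IsDist A x y d = Walk A x y d × (∀ ℓ → Walk A x y ℓ → d ≤ ℓ)

-- Sets of vertices are duplicate-free lists; cardinality is the length.

AtLeast : {V : Set} → ℕ → List V → (V → Set) → Set
AtLeast {V} k S P =
  Σ (List V) λ W → Unique W × All (_∈ S) W × All P W × k ≤ length W

Resolves : {V : Set} → Adj V → V → V → V → Set
Resolves A x y w = ∀ d₁ d₂ → IsDist A x w d₁ → IsDist A y w d₂ → d₁ ≢ d₂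

IsKMetricGenerator : {V : Set} → Adj V → ℕ → List V → Set
IsKMetricGenerator {V} A k S =
  Unique S × (∀ (x y : V) → x ≢ y → AtLeast k S (Resolves A x y))

IsDimK : {V : Set} → Adj V → ℕ → ℕ → Set
IsDimK {V} A k d =
  (Σ (List V) λ S → IsKMetricGenerator A k S × length S ≡ d)
  × (∀ (S : List V) → IsKMetricGenerator A k S → d ≤ length S)

AdjDistinguishes : {V : Set} → Adj V → V → V → V → Set
AdjDistinguishes A x y w = w ≡ x ⊎ w ≡ y ⊎ (A x w xor A y w) ≡ true

IsKAdjGenerator : {V : Set} → Adj V → ℕ → List V → Set
IsKAdjGenerator {V} A k S =
  Unique S × (∀ (x y : V) → x ≢ y → AtLeast k S (AdjDistinguishes A x y))

IsAdimK : {V : Set} → Adj V → ℕ → ℕ → Set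
IsAdimK {V} A k a =
  (Σ (List V) λ S → IsKAdjGenerator A k S × length S ≡ a)
  × (∀ (S : List V) → IsKAdjGenerator A k S → a ≤ length S)

LexV : (n : ℕ) → (Fin n → ℕ) → Set
LexV n m = Σ (Fin n) λ i → Fin (m i)

lexAdj : {n : ℕ} {m : Fin n → ℕ} → Graph n → ((i : Fin n) → Graph (m i))
       → Adj (LexV n m)
lexAdj G H (i , v) (j , w) with i ≟ j
... | yes refl = adj G i i ∨ adj (H i) v w
... | no _     = adj G i j

count : {A : Set} → (A → Bool) → List A → ℕ
count p []       = 0
count p (x ∷ xs) = (if p x then 1 else 0) + count p xs

degree : {m : ℕ} → Graph m → Fin m → ℕ
degree {m} H v = count (adj H v) (allFin m)

maxDeg : {m : ℕ} → Graph m → ℕ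
maxDeg {m} H = foldr _⊔_ 0 (map (degree H) (allFin m))

-- minimum degree δ(H); the seed m exceeds every degree, so for m ≥ 1
-- this is exactly the minimum of the degrees
minDeg : {m : ℕ} → Graph m → ℕ
minDeg {m} H = foldr _⊓_ m (map (degree H) (allFin m))

cSize : {m : ℕ} → Graph m → Fin m → Fin m → ℕ
cSize {m} H x y =
  count (λ w → ⌊ w ≟ x ⌋ ∨ ⌊ w ≟ y ⌋ ∨ (adj H x w xor adj H y w)) (allFin m)

k≤𝒞 : {n : ℕ} {m : Fin n → ℕ} → ℕ → ((i : Fin n) → Graph (m i)) → Set
k≤𝒞 {n} {m} k H = ∀ (i : Fin n) (x y : Fin (m i)) → x ≢ y → k ≤ cSize (H i) x y

TwinRel : {n : ℕ} → Graph n → Fin n → Fin n → Set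
TwinRel G x y = ∀ w → w ≢ x → w ≢ y → adj G x w ≡ adj G y w

InClass : {n : ℕ} → Graph n → Fin n → Fin n → Set
InClass G i j = j ≡ i ⊎ TwinRel G i j

InS : {n : ℕ} → Graph n → Fin n → Set
InS G i = ∀ j → j ≢ i → ¬ TwinRel G i j

InFT : {n : ℕ} → Graph n → Fin n → Set
InFT G i = Σ[ j ∈ _ ] j ≢ i × TwinRel G i j × adj G i j ≡ false

InTT : {n : ℕ} → Graph n → Fin n → Set
InTT G i = Σ[ j ∈ _ ] j ≢ i × TwinRel G i j × adj G i j ≡ true

k≤𝒯at : {n : ℕ} {m : Fin n → ℕ} → ℕ → Graph n → ((i : Fin n) → Graph (m i))
      → Fin n → Set
k≤𝒯at {n} {m} k G H i =
  (InS G i → k ≤ m i)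
  × (InFT G i → ∀ j l → InClass G i j → InClass G i l → j ≢ l →
       k ≤ minDeg (H j) + minDeg (H l) + 2)
  × (InTT G i → ∀ j l → InClass G i j → InClass G i l → j ≢ l →
       k ≤ (m j ∸ maxDeg (H j)) + (m l ∸ maxDeg (H l)))

k≤𝒯 : {n : ℕ} {m : Fin n → ℕ} → ℕ → Graph n → ((i : Fin n) → Graph (m i)) → Set
k≤𝒯 {n} k G H = ∀ (i : Fin n) → k≤𝒯at k G H i

ΣFin : {n : ℕ} → (Fin n → ℕ) → ℕ
ΣFin f = sum (tabulate f)

module Submission where

-- In G ∘ ℋ, two vertices (uᵢ , x) and (uᵢ , y) of the same layer are at equal
-- distance from every vertex outside that layer: a walk leaves the layer along an
-- edge of G, which is available from every vertex of the layer. Inside the layer,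
-- d((uᵢ , x) , (uᵢ , v)) is 1 or 2 according as xv ∈ E(Hᵢ) or not, the value 2
-- being realised through a neighbouring layer. So the vertices of a k-metric
-- generator S that resolve (uᵢ , x) and (uᵢ , y) lie in the layer Sᵢ of S and
-- distinguish x and y by adjacency in Hᵢ: each Sᵢ is a k-adjacency generator of Hᵢ,
-- whence Σ adim_k(Hᵢ) ≤ Σ |Sᵢ| ≤ |S|.

open import Defs
open import Data.Nat using (ℕ; _≤_)
open import Data.Fin using (Fin)

open import Data.Nat using (zero; suc; _+_; z≤n; s≤s)
open import Data.Nat.Properties
  using (≤-refl; ≤-trans; ≤-antisym; m≤n⇒m≤1+n; +-mono-≤; ≤∧≢⇒<; 1+n≰n; module ≤-Reasoning)
open import Data.Fin using (_≟_; fromℕ<; punchIn)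
open import Data.Fin.Properties using (any?; punchInᵢ≢i; <⇒≢)
open import Data.Bool using (true; false)
open import Data.Bool.Properties using () renaming (_≟_ to _≟ᵇ_)
open import Data.List using (List; []; _∷_; length; allFin; map; filter; tabulate; concat)
open import Data.List.Properties using (length-++; length-map; tabulate-cong)
open import Data.Nat.ListAction using (sum)
open import Data.List.Relation.Unary.All as All using (All; _∷_)
open import Data.List.Relation.Unary.AllPairs using (_∷_)
import Data.List.Relation.Unary.AllPairs.Properties as AllPairs
import Data.List.Relation.Unary.All.Properties as AllP
open import Data.List.Relation.Unary.Any using (here; there)
open import Data.List.Relation.Unary.Unique.Propositional using (Unique)
import Data.List.Relation.Unary.Unique.Propositional.Properties as Unique
open import Data.List.Relation.Binary.Subset.Propositional using (_⊆_)
open import Data.List.Membership.Propositional using (_∈_)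
open import Data.List.Membership.Propositional.Properties
  using (∈-filter⁺; ∈-filter⁻; ∈-allFin; ∈-map⁺; ∈-map⁻; ∈-concat⁻′; ∈-tabulate⁻)
open import Data.Product using (Σ; ∃; _×_; _,_; proj₁; proj₂)
open import Data.Product.Properties using (≡-dec)
open import Data.Product.Properties.WithK using (,-injectiveʳ)
open import Data.Sum using (_⊎_; inj₁; inj₂)
open import Data.Empty using (⊥-elim)
open import Function using (_∘_)
open import Relation.Binary.PropositionalEquality using (_≡_; _≢_; refl; trans; cong; subst; ≢-sym)
  renaming (sym to ≡-sym)
open import Relation.Binary.Definitions using (DecidableEquality)
open import Relation.Nullary using (Dec; yes; no; ¬_; contradiction)
open import Relation.Nullary.Decidable using (map′; _×-dec_)
open import Relation.Unary using (Decidable)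

remove-∈ : {A : Set} {x : A} {ys : List A} → x ∈ ys →
  ∃ λ ys′ → length ys ≡ suc (length ys′) × (∀ {z} → z ∈ ys → z ≢ x → z ∈ ys′)
remove-∈ {ys = _ ∷ ys} (here refl) =
  ys , refl , λ { (here z≡x) z≢x → contradiction z≡x z≢x ; (there z∈ys) _ → z∈ys }
remove-∈ {ys = y ∷ _} (there x∈ys) with ys′ , ∣ys∣≡ , keep ← remove-∈ x∈ys =
  y ∷ ys′ , cong suc ∣ys∣≡ , λ { (here z≡y) _ → here z≡y ; (there z∈ys) z≢x → there (keep z∈ys z≢x) }

Unique-⊆⇒length≤ : {A : Set} {xs ys : List A} → Unique xs → xs ⊆ ys → length xs ≤ length ys
Unique-⊆⇒length≤ {xs = []} _ _ = z≤n
Unique-⊆⇒length≤ {xs = x ∷ xs} (x≢xs ∷ !xs) xs⊆ys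
  with ys′ , ∣ys∣≡ , keep ← remove-∈ (xs⊆ys (here refl)) =
  subst (suc (length xs) ≤_) (≡-sym ∣ys∣≡)
    (s≤s (Unique-⊆⇒length≤ !xs λ z∈xs → keep (xs⊆ys (there z∈xs)) (≢-sym (All.lookup x≢xs z∈xs))))

ΣFin-mono : {n : ℕ} {f g : Fin n → ℕ} → (∀ i → f i ≤ g i) → ΣFin f ≤ ΣFin g
ΣFin-mono {zero} _ = z≤n
ΣFin-mono {suc n} f≤g = +-mono-≤ (f≤g Fin.zero) (ΣFin-mono (λ i → f≤g (Fin.suc i)))

length-concat-tabulate : {A : Set} {n : ℕ} (f : Fin n → List A) →
  length (concat (tabulate f)) ≡ ΣFin (λ i → length (f i))
length-concat-tabulate {n = zero} _ = refl
length-concat-tabulate {n = suc n} f = trans (length-++ (f Fin.zero))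
  (cong (length (f Fin.zero) +_) (length-concat-tabulate (λ i → f (Fin.suc i))))

Least : (ℕ → Set) → Set
Least P = Σ ℕ λ d → P d × (∀ ℓ → P ℓ → d ≤ ℓ)

module _ {P : ℕ → Set} (P? : Decidable P) where

  least-or-bound : ∀ N → Least P ⊎ (∀ ℓ → P ℓ → N ≤ ℓ)
  least-or-bound zero = inj₂ (λ _ _ → z≤n)
  least-or-bound (suc N) with least-or-bound N | P? N
  ... | inj₁ least | _     = inj₁ least
  ... | inj₂ bound | yes p = inj₁ (N , p , bound)
  ... | inj₂ bound | no ¬p = inj₂ λ ℓ pℓ → ≤∧≢⇒< (bound ℓ pℓ) λ { refl → ¬p pℓ }

  least : ∀ {ℓ} → P ℓ → Least P
  least {ℓ} pℓ with least-or-bound (suc ℓ)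
  ... | inj₁ l     = l
  ... | inj₂ bound = contradiction (bound ℓ pℓ) 1+n≰n

Searchable : Set → Set₁
Searchable V = ∀ {P : V → Set} → Decidable P → Dec (∃ P)

walk₀⇒≡ : {V : Set} {A : Adj V} {x y : V} → Walk A x y 0 → x ≡ y
walk₀⇒≡ here = refl

module _ {V : Set} (_≟ᵛ_ : DecidableEquality V) (search : Searchable V) (A : Adj V) where

  walk? : ∀ x y → Decidable (Walk A x y)
  walk? x y zero with x ≟ᵛ y
  ... | yes refl = yes here
  ... | no x≢y   = no (λ w → x≢y (walk₀⇒≡ w))
  walk? x y (suc ℓ) = map′ (λ (z , xz , w) → step xz w) (λ { (step xz w) → _ , xz , w })
    (search (λ z → (A x z ≟ᵇ true) ×-dec walk? z y ℓ))

  distance : ∀ {x y ℓ} → Walk A x y ℓ → Σ ℕ (IsDist A x y)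
  distance {x} {y} = least (walk? x y)

adj⇒≢ : {n : ℕ} (G : Graph n) {i j : Fin n} → adj G i j ≡ true → i ≢ j
adj⇒≢ G {i} ij refl with trans (≡-sym ij) (irrefl G i)
... | ()

walk⇒neighbour : {n : ℕ} (G : Graph n) {i j : Fin n} {ℓ : ℕ} → j ≢ i → Walk (adj G) i j ℓ →
  ∃ λ k → adj G i k ≡ true
walk⇒neighbour G j≢i here        = contradiction refl j≢i
walk⇒neighbour G j≢i (step ik _) = _ , ik

connected⇒neighbour : {n : ℕ} (G : Graph n) → 2 ≤ n → Connected (adj G) →
  ∀ i → ∃ λ j → adj G i j ≡ true
connected⇒neighbour G (s≤s (s≤s z≤n)) conn i =
  walk⇒neighbour G (punchInᵢ≢i i Fin.zero) (proj₂ (conn i (punchIn i Fin.zero)))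

module Lex {n : ℕ} (G : Graph n) {m : Fin n → ℕ} (H : (i : Fin n) → Graph (m i)) where

  V : Set
  V = LexV n m

  A : Adj V
  A = lexAdj G H

  embed : (i : Fin n) → Fin (m i) → V
  embed i v = i , v

  _≟ᵛ_ : DecidableEquality V
  _≟ᵛ_ = ≡-dec _≟_ _≟_

  searchV : Searchable V
  searchV P? = map′ (λ (i , v , p) → (i , v) , p) (λ ((i , v) , p) → i , v , p)
    (any? (λ i → any? (λ v → P? (i , v))))

  lexAdj-≢ : ∀ {i j} {v : Fin (m i)} {w : Fin (m j)} → i ≢ j → A (i , v) (j , w) ≡ adj G i j
  lexAdj-≢ {i} {j} i≢j with i ≟ j
  ... | yes refl = contradiction refl i≢j
  ... | no _     = refl

  lexAdj-≡ : ∀ {i} {v w : Fin (m i)} → A (i , v) (i , w) ≡ adj (H i) v w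
  lexAdj-≡ {i} with i ≟ i
  ... | yes refl rewrite irrefl G i = refl
  ... | no i≢i   = contradiction refl i≢i

  lift : (∀ j → Fin (m j)) → ∀ {i j ℓ} → Walk (adj G) i j (suc ℓ) →
    ∀ x w → Walk A (i , x) (j , w) (suc ℓ)
  lift pick (step ij here) x w = step (trans (lexAdj-≢ (adj⇒≢ G ij)) ij) here
  lift pick (step {y = k} ik (step kl w′)) x w =
    step (trans (lexAdj-≢ (adj⇒≢ G ik)) ik) (lift pick (step kl w′) (pick k) w)

  reroute : ∀ {i x b ℓ} → Walk A (i , x) b ℓ → proj₁ b ≢ i →
    ∀ y → ∃ λ ℓ′ → ℓ′ ≤ ℓ × Walk A (i , y) b ℓ′
  reroute here b∉i y = contradiction refl b∉i
  reroute {i} (step {y = j , v} xv w) b∉i y with j ≟ i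
  ... | yes refl with ℓ′ , ℓ′≤ , w′ ← reroute w b∉i y = ℓ′ , m≤n⇒m≤1+n ℓ′≤ , w′
  ... | no j≢i   = _ , ≤-refl , step (trans (lexAdj-≢ i≢j) (trans (≡-sym (lexAdj-≢ i≢j)) xv)) w
    where
    i≢j = ≢-sym j≢i

  IsDist-layer-≤ : ∀ {i x y b d₁ d₂} → proj₁ b ≢ i →
    IsDist A (i , x) b d₁ → IsDist A (i , y) b d₂ → d₁ ≤ d₂
  IsDist-layer-≤ b∉i (_ , min₁) (w₂ , _) with ℓ , ℓ≤d₂ , w ← reroute w₂ b∉i _ =
    ≤-trans (min₁ ℓ w) ℓ≤d₂

  ¬Resolves-outside-layer : Connected (adj G) → (∀ j → Fin (m j)) →
    ∀ {i j} (x y : Fin (m i)) (w : Fin (m j)) → i ≢ j → ¬ Resolves A (i , x) (i , y) (j , w)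
  ¬Resolves-outside-layer conn pick {i} {j} x y w i≢j R with conn i j
  ... | _ , here = i≢j refl
  ... | _ , step ik ws
    with d₁ , dist₁ ← distance _≟ᵛ_ searchV A (lift pick (step ik ws) x w)
       | d₂ , dist₂ ← distance _≟ᵛ_ searchV A (lift pick (step ik ws) y w) =
    R d₁ d₂ dist₁ dist₂ (≤-antisym (IsDist-layer-≤ j≢i dist₁ dist₂) (IsDist-layer-≤ j≢i dist₂ dist₁))
    where
    j≢i = ≢-sym i≢j

  IsDist-adjacent : ∀ {i} {x v : Fin (m i)} → adj (H i) x v ≡ true → IsDist A (i , x) (i , v) 1
  IsDist-adjacent {i} {x} {v} xv = step (trans lexAdj-≡ xv) here , shortest
    where
    shortest : ∀ ℓ → Walk A (i , x) (i , v) ℓ → 1 ≤ ℓ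
    shortest zero    w = contradiction (,-injectiveʳ (walk₀⇒≡ w)) (adj⇒≢ (H i) xv)
    shortest (suc ℓ) _ = s≤s z≤n

  IsDist-nonadjacent : ∀ {i j} → adj G i j ≡ true → Fin (m j) →
    ∀ {x v : Fin (m i)} → x ≢ v → adj (H i) x v ≡ false → IsDist A (i , x) (i , v) 2
  IsDist-nonadjacent {i} {j} ij z {x} {v} x≢v xv =
    step {y = j , z} (trans (lexAdj-≢ i≢j) ij)
      (step (trans (lexAdj-≢ (≢-sym i≢j)) (trans (sym G j i) ij)) here)
    , shortest
    where
    i≢j = adj⇒≢ G ij
    shortest : ∀ ℓ → Walk A (i , x) (i , v) ℓ → 2 ≤ ℓ
    shortest zero w = contradiction (,-injectiveʳ (walk₀⇒≡ w)) x≢v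
    shortest (suc zero) (step xu w) with refl ← walk₀⇒≡ w with () ← trans (≡-sym xu) (trans lexAdj-≡ xv)
    shortest (suc (suc ℓ)) _ = s≤s (s≤s z≤n)

  Resolves⇒AdjDistinguishes : ∀ {i j} → adj G i j ≡ true → Fin (m j) →
    ∀ {x y v : Fin (m i)} → Resolves A (i , x) (i , y) (i , v) → AdjDistinguishes (adj (H i)) x y v
  Resolves⇒AdjDistinguishes {i} ij z {x} {y} {v} R with v ≟ x | v ≟ y
  ... | yes v≡x | _       = inj₁ v≡x
  ... | no _    | yes v≡y = inj₂ (inj₁ v≡y)
  ... | no v≢x  | no v≢y with adj (H i) x v in xv | adj (H i) y v in yv
  ...   | true  | true  = ⊥-elim (R 1 1 (IsDist-adjacent xv) (IsDist-adjacent yv) refl)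
  ...   | true  | false = inj₂ (inj₂ refl)
  ...   | false | true  = inj₂ (inj₂ refl)
  ...   | false | false = ⊥-elim (R 2 2 (IsDist-nonadjacent ij z (≢-sym v≢x) xv)
                                        (IsDist-nonadjacent ij z (≢-sym v≢y) yv) refl)

  open import Data.List.Membership.DecPropositional _≟ᵛ_ using (_∈?_)

  layer : (i : Fin n) → List V → List (Fin (m i))
  layer i S = filter (λ v → (i , v) ∈? S) (allFin (m i))

  layer-unique : ∀ i S → Unique (layer i S)
  layer-unique i S = Unique.filter⁺ _ (Unique.allFin⁺ (m i))

  ∈-layer⁺ : ∀ {i v S} → (i , v) ∈ S → v ∈ layer i S
  ∈-layer⁺ {i} {v} iv∈S = ∈-filter⁺ (λ v → (i , v) ∈? _) (∈-allFin v) iv∈S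

  ∈-layer⁻ : ∀ {i v} S → v ∈ layer i S → (i , v) ∈ S
  ∈-layer⁻ {i} S v∈ = proj₂ (∈-filter⁻ (λ v → (i , v) ∈? S) {xs = allFin (m i)} v∈)

  length≤length-layer : ∀ i {S} → Unique S → All (λ u → proj₁ u ≡ i) S →
    length S ≤ length (layer i S)
  length≤length-layer i {S} !S S⊆i = begin
    length S                           ≤⟨ Unique-⊆⇒length≤ !S S⊆layer ⟩
    length (map (embed i) (layer i S)) ≡⟨ length-map (embed i) (layer i S) ⟩
    length (layer i S)                 ∎
    where
    open ≤-Reasoning
    S⊆layer : S ⊆ map (embed i) (layer i S)
    S⊆layer {j , v} u∈S with refl ← All.lookup S⊆i u∈S = ∈-map⁺ (embed i) (∈-layer⁺ u∈S)

  ΣFin-length-layer≤ : ∀ S → ΣFin (λ i → length (layer i S)) ≤ length S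
  ΣFin-length-layer≤ S = begin
    ΣFin (λ i → length (layer i S))          ≡⟨ cong sum (tabulate-cong length-embeddedLayer) ⟩
    ΣFin (λ i → length (embeddedLayer i))    ≡⟨ ≡-sym (length-concat-tabulate embeddedLayer) ⟩
    length (concat (tabulate embeddedLayer)) ≤⟨ Unique-⊆⇒length≤ layers-unique layers⊆S ⟩
    length S                                 ∎
    where
    open ≤-Reasoning
    embeddedLayer : (i : Fin n) → List V
    embeddedLayer i = map (embed i) (layer i S)

    length-embeddedLayer : ∀ i → length (layer i S) ≡ length (embeddedLayer i)
    length-embeddedLayer i = ≡-sym (length-map (embed i) (layer i S))

    inLayer : ∀ {i u} → u ∈ embeddedLayer i → proj₁ u ≡ i
    inLayer u∈ with _ , _ , refl ← ∈-map⁻ _ u∈ = refl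

    layers-unique : Unique (concat (tabulate embeddedLayer))
    layers-unique = Unique.concat⁺
      (AllP.tabulate⁺ (λ i → Unique.map⁺ ,-injectiveʳ (layer-unique i S)))
      (AllPairs.tabulate⁺-< (λ i<j (u∈i , u∈j) → <⇒≢ i<j (trans (≡-sym (inLayer u∈i)) (inLayer u∈j))))

    layers⊆S : concat (tabulate embeddedLayer) ⊆ S
    layers⊆S u∈ with _ , u∈L , L∈ ← ∈-concat⁻′ (tabulate embeddedLayer) u∈
                 with i , refl ← ∈-tabulate⁻ L∈
                 with v , v∈ , refl ← ∈-map⁻ (embed i) u∈L = ∈-layer⁻ S v∈

  resolver-in-layer : Connected (adj G) → (∀ j → Fin (m j)) →
    ∀ {i} {x y : Fin (m i)} {u} → Resolves A (i , x) (i , y) u → proj₁ u ≡ i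
  resolver-in-layer conn pick {i} {x} {y} {j , w} R with j ≟ i
  ... | yes j≡i = j≡i
  ... | no j≢i  = contradiction R (¬Resolves-outside-layer conn pick x y w (≢-sym j≢i))

  layer-isKAdjGenerator : Connected (adj G) → (∀ j → Fin (m j)) → (∀ i → ∃ λ j → adj G i j ≡ true) →
    ∀ {k S} → IsKMetricGenerator A k S → ∀ i → IsKAdjGenerator (adj (H i)) k (layer i S)
  layer-isKAdjGenerator conn pick neighbour {k} {S} (_ , resolving) i = layer-unique i S , adjResolving
    where
    adjResolving : ∀ x y → x ≢ y → AtLeast k (layer i S) (AdjDistinguishes (adj (H i)) x y)
    adjResolving x y x≢y
      with W , !W , W⊆S , W-resolves , k≤∣W∣ ← resolving (i , x) (i , y) (x≢y ∘ ,-injectiveʳ) =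
      layer i W , layer-unique i W
      , All.tabulate (λ v∈ → ∈-layer⁺ (All.lookup W⊆S (∈-layer⁻ W v∈)))
      , All.tabulate (λ v∈ → Resolves⇒AdjDistinguishes (proj₂ (neighbour i)) (pick _)
                                (All.lookup W-resolves (∈-layer⁻ W v∈)))
      , ≤-trans k≤∣W∣ (length≤length-layer i !W (All.map (resolver-in-layer conn pick) W-resolves))

-- The hypotheses 1 ≤ k, k ≤ 𝒯 and k ≤ 𝒞 only guarantee that the generators
-- realising d and the a i exist; the bound itself holds for every k.
theorem11 : (n : ℕ) → 2 ≤ n → (G : Graph n) → Connected (adj G)
    → (m : Fin n → ℕ) → (H : (i : Fin n) → Graph (m i)) → (∀ i → 2 ≤ m i)
    → (k : ℕ) → 1 ≤ k → k≤𝒯 k G H → k≤𝒞 k H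
    → (a : Fin n → ℕ) → (∀ i → IsAdimK (adj (H i)) k (a i))
    → (d : ℕ) → IsDimK (lexAdj G H) k d
    → ΣFin a ≤ d
theorem11 n 2≤n G conn m H 2≤m k _ _ _ a adim d ((S , S-generator , ∣S∣≡d) , _) = begin
  ΣFin a                          ≤⟨ ΣFin-mono (λ i → proj₂ (adim i) (layer i S) (S-layer-generator i)) ⟩
  ΣFin (λ i → length (layer i S)) ≤⟨ ΣFin-length-layer≤ S ⟩
  length S                        ≡⟨ ∣S∣≡d ⟩
  d                               ∎
  where
  open ≤-Reasoning
  open Lex G H
  pick : ∀ i → Fin (m i)
  pick i = fromℕ< (2≤m i)
  S-layer-generator : ∀ i → IsKAdjGenerator (adj (H i)) k (layer i S)
  S-layer-generator = layer-isKAdjGenerator conn pick (connected⇒neighbour G 2≤n conn) S-generator
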